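{- Let $(X,\leq,\top,\ominus)$ be a D-poset with canonical sum $\oplus$, and let $\mathbb{B}^\infty\mathcal{X}$ be the strict $\omega$-category obtained from it by iterating $\mathbb{B}$. Then its structure can be described as follows (writing $[m]=\{0<1<\dots<m\}$): 1. The set of $n$-cells is the set of monotone functions $[2n]\to X$. 2. For an $(n+1)$-cell $f$, its source $n$-cell is $s_n(f)(i)=f(i)$ for $0\leq i\leq n$ and $s_n(f)(i)=f(i+2)$ for $n<i\leq 2n$. 3. Its target $n$-cell is $t_n(f)(i)=f(i)$ for $0\leq i<n$ and $t_n(f)(i)=f(i+2)$ for $n\leq i\leq 2n$. 4. The identity $(n+1)$-cell on an $n$-cell $f$ is $Id_n(f)(i)=f(i)$ for $i<n$, $Id_n(f)(i)=f(n)$ for $n\leq i\leq n+2$, and $Id_n(f)(i)=f(i-2)$ for $n+2<i\leq 2n+2$. 5. For $(n+1)$-cells $f,g$ with $s_n(f)=t_n(g)$, their composite along $n$-cells is $c_n(f,g)(i)=g(i)$ for $i\leq n$, $c_n(f,g)(n+1)=(f(n+1)\ominus f(n))\oplus g(n+1)$, and $c_n(f,g)(i)=f(i)$ for $i\geq n+2$.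
   Context: A D-poset $(X,\leq,\top,\ominus)$ is a poset with top element $\top$ and a partial binary operation $\ominus$ such that: (1) $y\ominus x$ is defined precisely when $x\leq y$; (2) whenever $x\leq y$, $y\ominus x\leq y$ and $y\ominus(y\ominus x)=x$; (3) if $z\leq y\leq x$ then $x\ominus y\leq x\ominus z$ and $(x\ominus z)\ominus(x\ominus y)=y\ominus z$. Canonical sum: $a\oplus b:=c$ whenever $c\ominus b=a$ (defined iff $b\leq\top\ominus a$); bottom $\bot=a\ominus a$. For $x\leq y$, $\mathcal{X}_{x,y}$ is the D-poset with carrier $\{x\}\times\{t:t\leq y\ominus x\}\times\{y\}$, order and difference on the middle component. $\mathbb{B}\mathcal{X}$ is the category (enriched in effect algebras or $\emptyset$) with objects the elements of $X$, hom-objects $\mathcal{X}_{x,y}$ if $x\leq y$ and empty otherwise, identities $(x,\bot,x)$ and composition $(y,\phi,z)\circ(x,\psi,y)=(x,\phi\oplus\psi,z)$. $\mathbb{B}^\infty\mathcal{X}$ is the strict $\omega$-category obtained by inductively replacing each hom-object by $\mathbb{B}$ applied to it (change of enrichment along $\mathbb{B}$, which strictly preserves products and sends $\emptyset$ to the empty category); in particular its 0-cells are the elements of $X$ and a 1-cell from $x$ to $y$ is an element $\phi$ with $x\leq\phi\leq y$, recorded as the monotone map $[2]\to X$, $0\mapsto x,1\mapsto\phi,2\mapsto y$. -}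

module Defs where

open import Level using (Level; suc)
open import Data.Nat as ℕ using (ℕ; zero) renaming (suc to 1+)
open import Data.Fin using (Fin; toℕ)
open import Data.Product using (Σ; _,_; proj₁; proj₂)
open import Relation.Binary.PropositionalEquality using (_≡_; refl; cong)

-- The partial difference y ⊖ x is defined
-- precisely when x ≤ y: it takes a proof of x ≤ y as argument (axiom (1)).
-- The order is a proposition (as for a relation on a set), so the value
-- of y ⊖ x does not depend on the chosen proof.
record DPoset (ℓ : Level) : Set (suc ℓ) where
  field
    Carrier   : Set ℓ
    _≤_       : Carrier → Carrier → Set ℓ
    ≤-prop    : ∀ {x y} (p q : x ≤ y) → p ≡ q
    ≤-refl    : ∀ {x} → x ≤ x
    ≤-trans   : ∀ {x y z} → x ≤ y → y ≤ z → x ≤ z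
    ≤-antisym : ∀ {x y} → x ≤ y → y ≤ x → x ≡ y
    ⊤         : Carrier
    ≤⊤        : ∀ x → x ≤ ⊤
    diff      : (y x : Carrier) → x ≤ y → Carrier
    ⊖-≤       : ∀ {x y} (p : x ≤ y) → diff y x p ≤ y
    ⊖-inv     : ∀ {x y} (p : x ≤ y) → diff y (diff y x p) (⊖-≤ p) ≡ x
    ⊖-anti    : ∀ {x y z} (zy : z ≤ y) (yx : y ≤ x) →
                diff x y yx ≤ diff x z (≤-trans zy yx)
    ⊖-comp    : ∀ {x y z} (zy : z ≤ y) (yx : y ≤ x) →
                diff (diff x z (≤-trans zy yx)) (diff x y yx) (⊖-anti zy yx)
                  ≡ diff y z zy

  ⊥ : Carrier
  ⊥ = diff ⊤ ⊤ ≤-refl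

open DPoset

-- Canonical sum, as a relation:  IsSum X a b c  means  a ⊕ b = c,
-- i.e. c ⊖ b (defined, b ≤ c) equals a.
IsSum : ∀ {ℓ} (X : DPoset ℓ) → Carrier X → Carrier X → Carrier X → Set ℓ
IsSum X a b c = Σ (_≤_ X b c) λ q → diff X c b q ≡ a

IsMonotone : ∀ {ℓ} (X : DPoset ℓ) {m : ℕ} → (Fin (1+ m) → Carrier X) → Set ℓ
IsMonotone X f = ∀ i j → toℕ i ℕ.≤ toℕ j → _≤_ X (f i) (f j)

-- The D-poset X_{x,y} (for x ≤ y): carrier {t : t ≤ y ⊖ x}, order and
-- difference computed in X, top y ⊖ x.  (The redundant tags x, y of the
-- paper's triples (x, t, y) are dropped from the carrier.)
module _ {ℓ} (X : DPoset ℓ) where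
  private
    C = Carrier X

  Hom : (x y : C) → _≤_ X x y → DPoset ℓ
  Hom x y p = record
    { Carrier   = S
    ; _≤_       = λ s t → _≤_ X (proj₁ s) (proj₁ t)
    ; ≤-prop    = ≤-prop X
    ; ≤-refl    = ≤-refl X
    ; ≤-trans   = ≤-trans X
    ; ≤-antisym = λ a b → S≡ (≤-antisym X a b)
    ; ⊤         = (b , ≤-refl X)
    ; ≤⊤        = λ s → proj₂ s
    ; diff      = λ t s r → (diff X (proj₁ t) (proj₁ s) r , ≤-trans X (⊖-≤ X r) (proj₂ t))
    ; ⊖-≤       = ⊖-≤ X
    ; ⊖-inv     = λ r → S≡ (⊖-inv X r)
    ; ⊖-anti    = ⊖-anti X
    ; ⊖-comp    = λ zy yx → S≡ (⊖-comp X zy yx)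
    }
    where
    b : C
    b = diff X y x p
    S : Set ℓ
    S = Σ C λ t → _≤_ X t b
    S≡ : {s t : S} → proj₁ s ≡ proj₁ t → s ≡ t
    S≡ {s , a} {.s , a'} refl = cong (s ,_) (≤-prop X a a')

-- Cells of the strict ω-category  B^∞ X :
--   0-cells are elements of X; an (n+1)-cell is a pair x ≤ y of elements
--   together with an n-cell of B^∞ (X_{x,y}).
Cell : ∀ {ℓ} → ℕ → DPoset ℓ → Set ℓ
Cell zero     X = Carrier X
Cell (1+ n)   X = Σ (Carrier X) λ x → Σ (Carrier X) λ y → Σ (_≤_ X x y) λ p →
                    Cell n (Hom X x y p)

src : ∀ {ℓ} (n : ℕ) (X : DPoset ℓ) → Cell (1+ n) X → Cell n X
src zero   X (x , y , p , c) = x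
src (1+ n) X (x , y , p , c) = (x , y , p , src n (Hom X x y p) c)

tgt : ∀ {ℓ} (n : ℕ) (X : DPoset ℓ) → Cell (1+ n) X → Cell n X
tgt zero   X (x , y , p , c) = y
tgt (1+ n) X (x , y , p , c) = (x , y , p , tgt n (Hom X x y p) c)

idc : ∀ {ℓ} (n : ℕ) (X : DPoset ℓ) → Cell n X → Cell (1+ n) X
idc zero   X x = (x , x , ≤-refl X , ⊥ (Hom X x x (≤-refl X)))
idc (1+ n) X (x , y , p , c) = (x , y , p , idc n (Hom X x y p) c)

-- composition of (n+1)-cells along n-cells, as the graph relation
-- Comp n X f g h  :  h = c_n(f, g)  (f after g).
-- In B X:  (y, φ, z) ∘ (x, ψ, y) = (x, φ ⊕ ψ, z), ⊕ the canonical sum of X.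
data Comp {ℓ} : (n : ℕ) (X : DPoset ℓ) →
                Cell (1+ n) X → Cell (1+ n) X → Cell (1+ n) X → Set (suc ℓ) where
  comp₀ : ∀ {X x y z p q r φ ψ χ} →
          IsSum X (proj₁ φ) (proj₁ ψ) (proj₁ χ) →
          Comp zero X (y , z , q , φ) (x , y , p , ψ) (x , z , r , χ)
  compₛ : ∀ {n X x y p f g h} →
          Comp n (Hom X x y p) f g h →
          Comp (1+ n) X (x , y , p , f) (x , y , p , g) (x , y , p , h)

-- For x ≤ y the map t ↦ t ⊕ x is an order isomorphism from X_{x,y} onto the
-- interval [x, y] of X, and it preserves differences.  Unfolding an (n+1)-cell
-- (x, y, c) through it turns the chain of the n-cell c into the chain
-- x ≤ c(0) ⊕ x ≤ … ≤ c(2n) ⊕ x ≤ y in X, so by induction n-cells are exactly the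
-- monotone maps [2n] → X.  Source, target, identity and composition act on the
-- innermost 1-cell (a, φ, b), which occupies positions n, n+1, n+2 of the chain:
-- the source keeps a, the target keeps b, the identity repeats a point, and
-- composition forms φ ⊕ ψ there, which the difference-preserving isomorphisms
-- carry to (f(n+1) ⊖ f(n)) ⊕ g(n+1) in X.
module Submission where

open import Defs
open import Data.Empty using (⊥-elim)
open import Data.Fin using (Fin; toℕ; fromℕ<)
import Data.Fin.Properties as Finₚ
open import Data.Nat
  using (ℕ; zero; suc; _+_; _*_; _<_; _⊓_; _≤?_; z≤n; s≤s; s≤s⁻¹; s<s⁻¹) renaming (_≤_ to _≤ℕ_)
import Data.Nat.Properties as ℕₚ
open import Data.Product using (Σ; _×_; _,_; proj₁; proj₂)
open import Data.Sum using (_⊎_; inj₁; inj₂)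
open import Function using (_∘_)
open import Relation.Binary.PropositionalEquality
open import Relation.Nullary using (yes; no)

open DPoset using (Carrier)

module DPosetProperties {ℓ} (X : DPoset ℓ) where
  open DPoset X hiding (Carrier)

  private variable
    a a' b b' c c' w x x' y y' z : Carrier X

  ≤-reflexive : x ≡ y → x ≤ y
  ≤-reflexive refl = ≤-refl

  diff-cong : x ≡ x' → y ≡ y' → (p : y ≤ x) (p' : y' ≤ x') → diff x y p ≡ diff x' y' p'
  diff-cong refl refl p p' = cong (diff _ _) (≤-prop p p')

  ⊖-involutive : (p : x ≤ y) (q : diff y x p ≤ y) → diff y (diff y x p) q ≡ x
  ⊖-involutive p q = trans (diff-cong refl refl q (⊖-≤ p)) (⊖-inv p)

  ⊖-antimonoʳ-≤ : z ≤ y → (yx : y ≤ x) (zx : z ≤ x) → diff x y yx ≤ diff x z zx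
  ⊖-antimonoʳ-≤ zy yx zx = ≤-trans (⊖-anti zy yx) (≤-reflexive (diff-cong refl refl _ zx))

  ⊖-⊖ : (zy : z ≤ y) (yx : y ≤ x) (zx : z ≤ x) (q : diff x y yx ≤ diff x z zx) →
        diff (diff x z zx) (diff x y yx) q ≡ diff y z zy
  ⊖-⊖ zy yx zx q = trans (diff-cong (diff-cong refl refl zx _) refl q (⊖-anti zy yx)) (⊖-comp zy yx)

  ⊖-monoˡ-≤ : (zy : z ≤ y) → y ≤ x → (zx : z ≤ x) → diff y z zy ≤ diff x z zx
  ⊖-monoˡ-≤ zy yx zx =
    ≤-trans (≤-reflexive (sym (⊖-⊖ zy yx zx (⊖-antimonoʳ-≤ zy yx zx)))) (⊖-≤ _)

  ⊖-cancelʳ : (zy : z ≤ y) (yx : y ≤ x) (zx : z ≤ x) (q : diff y z zy ≤ diff x z zx) →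
              diff (diff x z zx) (diff y z zy) q ≡ diff x y yx
  ⊖-cancelʳ zy yx zx q =
    trans (diff-cong refl (sym (⊖-⊖ zy yx zx m)) q (⊖-≤ m)) (⊖-involutive m _)
    where m = ⊖-antimonoʳ-≤ zy yx zx

  infix 30 ⊤⊖_ _⊕_[_]

  ⊤⊖_ : Carrier X → Carrier X
  ⊤⊖ a = diff ⊤ a (≤⊤ a)

  ⊤⊖-involutive : ⊤⊖ (⊤⊖ a) ≡ a
  ⊤⊖-involutive = ⊖-involutive (≤⊤ _) (≤⊤ _)

  -- The paper's condition b ≤ ⊤ ⊖ a for a ⊕ b to exist is replaced by the
  -- equivalent a ≤ ⊤ ⊖ b, under which ⊤ ⊖ ((⊤ ⊖ b) ⊖ a) is defined.
  _⊕_[_] : (a b : Carrier X) → a ≤ ⊤⊖ b → Carrier X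
  a ⊕ b [ h ] = ⊤⊖ diff (⊤⊖ b) a h

  ≤-⊕ : (h : a ≤ ⊤⊖ b) → b ≤ a ⊕ b [ h ]
  ≤-⊕ h = ≤-trans (≤-reflexive (sym ⊤⊖-involutive)) (⊖-antimonoʳ-≤ (⊖-≤ h) (≤⊤ _) (≤⊤ _))

  ⊕-⊖ : (h : a ≤ ⊤⊖ b) (q : b ≤ a ⊕ b [ h ]) → diff (a ⊕ b [ h ]) b q ≡ a
  ⊕-⊖ h q = begin
    diff (⊤⊖ diff (⊤⊖ _) _ h) _ q                   ≡⟨ diff-cong refl (sym ⊤⊖-involutive) q r ⟩
    diff (⊤⊖ diff (⊤⊖ _) _ h) (⊤⊖ (⊤⊖ _)) r        ≡⟨ ⊖-⊖ (⊖-≤ h) (≤⊤ _) (≤⊤ _) r ⟩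
    diff (⊤⊖ _) (diff (⊤⊖ _) _ h) (⊖-≤ h)           ≡⟨ ⊖-involutive h _ ⟩
    _                                               ∎
    where
    open ≡-Reasoning
    r = ⊖-antimonoʳ-≤ (⊖-≤ h) (≤⊤ _) (≤⊤ _)

  ⊕-isSum : (h : a ≤ ⊤⊖ b) → IsSum X a b (a ⊕ b [ h ])
  ⊕-isSum h = ≤-⊕ h , ⊕-⊖ h (≤-⊕ h)

  ⊕-monoˡ-≤ : (h' : a' ≤ ⊤⊖ b) (h : a ≤ ⊤⊖ b) → a' ≤ a → a' ⊕ b [ h' ] ≤ a ⊕ b [ h ]
  ⊕-monoˡ-≤ h' h a'a = ⊖-antimonoʳ-≤ (⊖-antimonoʳ-≤ a'a h h') (≤⊤ _) (≤⊤ _)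

  ⊕-⊖-⊕ : (h' : a' ≤ ⊤⊖ b) (h : a ≤ ⊤⊖ b) (a'a : a' ≤ a) (q : a' ⊕ b [ h' ] ≤ a ⊕ b [ h ]) →
          diff (a ⊕ b [ h ]) (a' ⊕ b [ h' ]) q ≡ diff a a' a'a
  ⊕-⊖-⊕ h' h a'a q =
    trans (⊖-⊖ (⊖-antimonoʳ-≤ a'a h h') (≤⊤ _) (≤⊤ _) q) (⊖-⊖ a'a h h' _)

  ⊖-⊕ : (bw : b ≤ w) (h : diff w b bw ≤ ⊤⊖ b) → diff w b bw ⊕ b [ h ] ≡ w
  ⊖-⊕ bw h = begin
    ⊤⊖ diff (⊤⊖ _) (diff _ _ bw) h                 ≡⟨ cong ⊤⊖_ (diff-cong refl (sym w⊖b) h (⊖-≤ m)) ⟩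
    ⊤⊖ diff (⊤⊖ _) (diff (⊤⊖ _) (⊤⊖ _) m) (⊖-≤ m) ≡⟨ cong ⊤⊖_ (⊖-involutive m _) ⟩
    ⊤⊖ (⊤⊖ _)                                      ≡⟨ ⊤⊖-involutive ⟩
    _                                              ∎
    where
    open ≡-Reasoning
    m = ⊖-antimonoʳ-≤ bw (≤⊤ _) (≤⊤ _)
    w⊖b = ⊖-⊖ bw (≤⊤ _) (≤⊤ _) m

  ⊕-≤ : (h : a ≤ ⊤⊖ b) (by : b ≤ y) → a ≤ diff y b by → a ⊕ b [ h ] ≤ y
  ⊕-≤ h by ay = ≤-trans (⊖-antimonoʳ-≤ ⊤⊖y≤ (≤⊤ _) (≤⊤ _)) (≤-reflexive ⊤⊖-involutive)
    where
    m = ⊖-antimonoʳ-≤ by (≤⊤ _) (≤⊤ _)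
    -- ⊤ ⊖ y = (⊤ ⊖ b) ⊖ (y ⊖ b), and y ⊖ b ≥ a
    ⊤⊖y≤ : ⊤⊖ _ ≤ diff (⊤⊖ _) _ h
    ⊤⊖y≤ = ≤-trans (≤-reflexive (sym (⊖-involutive m (⊖-≤ m))))
             (⊖-antimonoʳ-≤ (≤-trans ay (≤-reflexive (sym (⊖-⊖ by (≤⊤ _) (≤⊤ _) m)))) (⊖-≤ m) h)

  IsSum-cong : a ≡ a' → b ≡ b' → c ≡ c' → IsSum X a' b' c' → IsSum X a b c
  IsSum-cong refl refl refl s = s

  IsSum-⊕ʳ : (h : a ≤ ⊤⊖ w) (h' : a' ≤ ⊤⊖ w) → IsSum X b a a' → IsSum X b (a ⊕ w [ h ]) (a' ⊕ w [ h' ])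
  IsSum-⊕ʳ h h' (aa' , e) = ⊕-monoˡ-≤ h h' aa' , trans (⊕-⊖-⊕ h h' aa' _) e

module Interval {ℓ} (X : DPoset ℓ) {x y : Carrier X} (p : DPoset._≤_ X x y) where
  open DPoset X hiding (Carrier)
  open DPosetProperties X

  private
    Y = Hom X x y p
    variable
      s s' t : Carrier Y
      w : Carrier X

  ι : Carrier Y → Carrier X
  ι s = proj₁ s ⊕ x [ ≤-trans (proj₂ s) (⊖-monoˡ-≤ p (≤⊤ y) (≤⊤ x)) ]

  ι-mono : DPoset._≤_ Y s s' → ι s ≤ ι s'
  ι-mono = ⊕-monoˡ-≤ _ _

  ≤-ι : ∀ s → x ≤ ι s
  ≤-ι s = ≤-⊕ _

  ι-≤ : ∀ s → ι s ≤ y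
  ι-≤ s = ⊕-≤ _ p (proj₂ s)

  ι-⊖ : (q : x ≤ ι s) → diff (ι s) x q ≡ proj₁ s
  ι-⊖ = ⊕-⊖ _

  ι-⊖-ι : (ss' : DPoset._≤_ Y s s') (q : ι s ≤ ι s') → diff (ι s') (ι s) q ≡ diff (proj₁ s') (proj₁ s) ss'
  ι-⊖-ι = ⊕-⊖-⊕ _ _

  ⊖x : x ≤ w → w ≤ y → Carrier Y
  ⊖x xw wy = diff _ x xw , ⊖-monoˡ-≤ xw wy p

  ι-⊖x : (xw : x ≤ w) (wy : w ≤ y) → ι (⊖x xw wy) ≡ w
  ι-⊖x xw wy = ⊖-⊕ xw _

  proj₁-injective : proj₁ s ≡ proj₁ s' → s ≡ s'
  proj₁-injective {_ , sy} {_ , s'y} refl = cong (_ ,_) (≤-prop sy s'y)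

  ι-injective : ι s ≡ ι s' → s ≡ s'
  ι-injective {s} {s'} eq = proj₁-injective
    (trans (sym (ι-⊖ (≤-ι s))) (trans (diff-cong eq refl (≤-ι s) (≤-ι s')) (ι-⊖ (≤-ι s'))))

  IsSum-proj₁ : IsSum Y s s' t → IsSum X (proj₁ s) (proj₁ s') (proj₁ t)
  IsSum-proj₁ (s't , e) = s't , cong proj₁ e

open Interval using (ι)

2*suc≡2+2* : ∀ n → 2 * suc n ≡ 2 + 2 * n
2*suc≡2+2* = ℕₚ.*-suc 2

≤⇒≤2* : ∀ {k n} → k ≤ℕ n → k ≤ℕ 2 * n
≤⇒≤2* {n = n} k≤n = ℕₚ.≤-trans k≤n (ℕₚ.m≤m+n n _)

≤2*⇒2+≤2*suc : ∀ {k} n → k ≤ℕ 2 * n → 2 + k ≤ℕ 2 * suc n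
≤2*⇒2+≤2*suc n k≤ = ℕₚ.≤-trans (s≤s (s≤s k≤)) (ℕₚ.≤-reflexive (sym (2*suc≡2+2* n)))

≤2*⇒suc≤2*suc : ∀ {k} n → k ≤ℕ 2 * n → suc k ≤ℕ 2 * suc n
≤2*⇒suc≤2*suc n k≤ = ℕₚ.≤-trans (ℕₚ.n≤1+n _) (≤2*⇒2+≤2*suc n k≤)

2*<⇒2*suc<2+ : ∀ {k} n → 2 * n < k → 2 * suc n < 2 + k
2*<⇒2*suc<2+ n <k = ℕₚ.≤-trans (s≤s (ℕₚ.≤-reflexive (2*suc≡2+2* n))) (s≤s (s≤s <k))

2+≤2*suc⇒≤2* : ∀ {k} n → 2 + k ≤ℕ 2 * suc n → k ≤ℕ 2 * n
2+≤2*suc⇒≤2* n 2+k≤ = s≤s⁻¹ (s≤s⁻¹ (ℕₚ.≤-trans 2+k≤ (ℕₚ.≤-reflexive (2*suc≡2+2* n))))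

2*suc<2+⇒2*< : ∀ {k} n → 2 * suc n < 2 + k → 2 * n < k
2*suc<2+⇒2*< n <2+k = s<s⁻¹ (s<s⁻¹ (ℕₚ.≤-trans (s≤s (ℕₚ.≤-reflexive (sym (2*suc≡2+2* n)))) <2+k))

-- The monotone map [2n] → X of an n-cell, extended to ℕ by its value at 2n
-- (for n ≥ 1 this is the top of the outermost interval).
chain : ∀ {ℓ} n (X : DPoset ℓ) → Cell n X → ℕ → Carrier X
chain zero    X x k = x
chain (suc n) X (x , y , p , c) zero = x
chain (suc n) X (x , y , p , c) (suc k) with k ≤? 2 * n
... | yes _ = ι X p (chain n (Hom X x y p) c k)
... | no  _ = y

module _ {ℓ} {X : DPoset ℓ} {x y : Carrier X} {p : DPoset._≤_ X x y} where
  open DPoset X hiding (Carrier)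

  chain-suc-≤ : ∀ n (c : Cell n (Hom X x y p)) {k} → k ≤ℕ 2 * n →
                chain (suc n) X (x , y , p , c) (suc k) ≡ ι X p (chain n (Hom X x y p) c k)
  chain-suc-≤ n c {k} k≤ with k ≤? 2 * n
  ... | yes _ = refl
  ... | no k≰ = ⊥-elim (k≰ k≤)

  chain-suc-> : ∀ n (c : Cell n (Hom X x y p)) {k} → 2 * n < k →
                chain (suc n) X (x , y , p , c) (suc k) ≡ y
  chain-suc-> n c {k} <k with k ≤? 2 * n
  ... | yes k≤ = ⊥-elim (ℕₚ.<⇒≱ <k k≤)
  ... | no _ = refl

  chain-suc-cong : ∀ n n' (c : Cell n (Hom X x y p)) (c' : Cell n' (Hom X x y p)) k k' →
    (k ≤ℕ 2 * n → k' ≤ℕ 2 * n' × chain n _ c k ≡ chain n' _ c' k') →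
    (2 * n < k → 2 * n' < k') →
    chain (suc n) X (x , y , p , c) (suc k) ≡ chain (suc n') X (x , y , p , c') (suc k')
  chain-suc-cong n n' c c' k k' inner outer with k ≤? 2 * n
  ... | yes k≤ = trans (cong (ι X p) (proj₂ (inner k≤))) (sym (chain-suc-≤ n' c' (proj₁ (inner k≤))))
  ... | no k≰ = sym (chain-suc-> n' c' (outer (ℕₚ.≰⇒> k≰)))

  ≤-chain : ∀ n (c : Cell n (Hom X x y p)) k → x ≤ chain (suc n) X (x , y , p , c) k
  ≤-chain n c zero = ≤-refl
  ≤-chain n c (suc k) with k ≤? 2 * n
  ... | yes _ = Interval.≤-ι X p _
  ... | no _ = p

chain-mono : ∀ {ℓ} n (X : DPoset ℓ) c {k l} → k ≤ℕ l → DPoset._≤_ X (chain n X c k) (chain n X c l)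
chain-mono zero X c _ = DPoset.≤-refl X
chain-mono (suc n) X (x , y , p , c) {zero} {l} _ = ≤-chain n c l
chain-mono (suc n) X (x , y , p , c) {suc k} {suc l} (s≤s k≤l) with k ≤? 2 * n | l ≤? 2 * n
... | yes _  | yes _  = Interval.ι-mono X p (chain-mono n (Hom X x y p) c k≤l)
... | yes _  | no _   = Interval.ι-≤ X p _
... | no k≰  | yes l≤ = ⊥-elim (k≰ (ℕₚ.≤-trans k≤l l≤))
... | no _   | no _   = DPoset.≤-refl X

chain-injective : ∀ {ℓ} n (X : DPoset ℓ) c d →
                  (∀ k → k ≤ℕ 2 * n → chain n X c k ≡ chain n X d k) → c ≡ d
chain-injective zero X c d agree = agree 0 z≤n
chain-injective (suc n) X (x , y , p , c) (x' , y' , p' , d) agree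
  with refl ← agree 0 z≤n
  with refl ← trans (sym (chain-suc-> n c (ℕₚ.n<1+n _)))
                (trans (agree (2 + 2 * n) (≤2*⇒2+≤2*suc n ℕₚ.≤-refl)) (chain-suc-> n d (ℕₚ.n<1+n _)))
  with refl ← DPoset.≤-prop X p p'
  = cong (λ e → x , y , p , e) (chain-injective n (Hom X x y p) c d λ k k≤ →
      Interval.ι-injective X p (begin
        ι X p (chain n _ c k)         ≡⟨ sym (chain-suc-≤ n c k≤) ⟩
        chain (suc n) X _ (suc k)     ≡⟨ agree (suc k) (≤2*⇒suc≤2*suc n k≤) ⟩
        chain (suc n) X _ (suc k)     ≡⟨ chain-suc-≤ n d k≤ ⟩
        ι X p (chain n _ d k)         ∎))
  where open ≡-Reasoning

chain-surjective : ∀ {ℓ} n (X : DPoset ℓ) (g : ℕ → Carrier X) →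
                   (∀ {k l} → k ≤ℕ l → DPoset._≤_ X (g k) (g l)) →
                   Σ (Cell n X) λ c → ∀ k → k ≤ℕ 2 * n → chain n X c k ≡ g k
chain-surjective zero X g g-mono = g 0 , λ { zero _ → refl }
chain-surjective (suc n) X g g-mono = (g 0 , g top , p , proj₁ IH) , agree
  where
  open DPosetProperties X
  top = 2 + 2 * n
  p = g-mono z≤n
  -- the inner cell only sees g on [1, 2n+1]; clamping keeps it monotone on all of ℕ
  clamp : ℕ → ℕ
  clamp k = suc (k ⊓ (2 * n))
  clamp≤top : ∀ k → clamp k ≤ℕ top
  clamp≤top k = s≤s (ℕₚ.m≤n⇒m≤1+n (ℕₚ.m⊓n≤n k (2 * n)))
  g' : ℕ → Carrier (Hom X (g 0) (g top) p)
  g' k = Interval.⊖x X p (g-mono z≤n) (g-mono (clamp≤top k))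
  IH = chain-surjective n (Hom X (g 0) (g top) p) g'
         λ k≤l → ⊖-monoˡ-≤ _ (g-mono (s≤s (ℕₚ.⊓-monoˡ-≤ (2 * n) k≤l))) _
  agree : ∀ k → k ≤ℕ 2 * suc n → chain (suc n) X (g 0 , g top , p , proj₁ IH) k ≡ g k
  agree zero _ = refl
  agree (suc k) sk≤ with k ≤? 2 * n
  ... | yes k≤ = begin
    ι X p (chain n _ (proj₁ IH) k) ≡⟨ cong (ι X p) (proj₂ IH k k≤) ⟩
    ι X p (g' k)                   ≡⟨ Interval.ι-⊖x X p _ _ ⟩
    g (clamp k)                    ≡⟨ cong (g ∘ suc) (ℕₚ.m≤n⇒m⊓n≡m k≤) ⟩
    g (suc k)                      ∎
    where open ≡-Reasoning
  ... | no k≰ = cong g (ℕₚ.≤-antisym (s≤s (ℕₚ.≰⇒> k≰))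
                                   (ℕₚ.≤-trans sk≤ (ℕₚ.≤-reflexive (2*suc≡2+2* n))))

chain-src-≤ : ∀ {ℓ} n (X : DPoset ℓ) f {k} → k ≤ℕ n → chain n X (src n X f) k ≡ chain (suc n) X f k
chain-src-≤ zero    X (x , y , p , c) {zero} _ = refl
chain-src-≤ (suc m) X (x , y , p , c) {zero} _ = refl
chain-src-≤ (suc m) X (x , y , p , c) {suc k} (s≤s k≤m) =
  chain-suc-cong m (suc m) (src m _ c) c k k
    (λ _ → ≤⇒≤2* (ℕₚ.m≤n⇒m≤1+n k≤m) , chain-src-≤ m _ c k≤m)
    (λ 2m<k → ⊥-elim (ℕₚ.<⇒≱ 2m<k (≤⇒≤2* k≤m)))

chain-src-> : ∀ {ℓ} n (X : DPoset ℓ) f {k} → n < k → k ≤ℕ 2 * n →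
              chain n X (src n X f) k ≡ chain (suc n) X f (2 + k)
chain-src-> zero    X f {suc k} _ ()
chain-src-> (suc m) X (x , y , p , c) {suc k} (s≤s m<k) _ =
  chain-suc-cong m (suc m) (src m _ c) c k (2 + k)
    (λ k≤2m → ≤2*⇒2+≤2*suc m k≤2m , chain-src-> m _ c m<k k≤2m)
    (2*<⇒2*suc<2+ m)

chain-tgt-< : ∀ {ℓ} n (X : DPoset ℓ) f {k} → k < n → chain n X (tgt n X f) k ≡ chain (suc n) X f k
chain-tgt-< (suc m) X (x , y , p , c) {zero} _ = refl
chain-tgt-< (suc m) X (x , y , p , c) {suc k} (s≤s k<m) =
  chain-suc-cong m (suc m) (tgt m _ c) c k k
    (λ _ → ≤⇒≤2* (ℕₚ.m≤n⇒m≤1+n (ℕₚ.<⇒≤ k<m)) , chain-tgt-< m _ c k<m)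
    (λ 2m<k → ⊥-elim (ℕₚ.<⇒≱ 2m<k (≤⇒≤2* (ℕₚ.<⇒≤ k<m))))

chain-tgt-≥ : ∀ {ℓ} n (X : DPoset ℓ) f {k} → n ≤ℕ k → k ≤ℕ 2 * n →
              chain n X (tgt n X f) k ≡ chain (suc n) X f (2 + k)
chain-tgt-≥ zero    X (x , y , p , c) {zero} _ _ = refl
chain-tgt-≥ (suc m) X (x , y , p , c) {suc k} (s≤s m≤k) _ =
  chain-suc-cong m (suc m) (tgt m _ c) c k (2 + k)
    (λ k≤2m → ≤2*⇒2+≤2*suc m k≤2m , chain-tgt-≥ m _ c m≤k k≤2m)
    (2*<⇒2*suc<2+ m)

chain-idc-zero : ∀ {ℓ} (X : DPoset ℓ) x k → chain 1 X (idc 0 X x) k ≡ x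
chain-idc-zero X x zero = refl
chain-idc-zero X x (suc zero) = begin
  ι X r (DPoset.⊥ (Hom X x x r)) ≡⟨ cong (ι X r) (Interval.proj₁-injective X r (⊖-⊖ r r r _)) ⟩
  ι X r (Interval.⊖x X r r r)    ≡⟨ Interval.ι-⊖x X r r r ⟩
  x                              ∎
  where
  open ≡-Reasoning
  open DPosetProperties X
  r = DPoset.≤-refl X
chain-idc-zero X x (suc (suc k)) =
  chain-suc-> {X = X} {x} {x} {r} 0 (DPoset.⊥ (Hom X x x r)) {suc k} (s≤s z≤n)
  where r = DPoset.≤-refl X

chain-idc-< : ∀ {ℓ} n (X : DPoset ℓ) g {j} → j < n → chain (suc n) X (idc n X g) j ≡ chain n X g j
chain-idc-< (suc m) X (x , y , p , c) {zero} _ = refl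
chain-idc-< (suc m) X (x , y , p , c) {suc j} (s≤s j<m) =
  chain-suc-cong (suc m) m (idc m _ c) c j j
    (λ _ → ≤⇒≤2* (ℕₚ.<⇒≤ j<m) , chain-idc-< m _ c j<m)
    (λ 2sm<j → ⊥-elim (ℕₚ.<⇒≱ 2sm<j (≤⇒≤2* (ℕₚ.m≤n⇒m≤1+n (ℕₚ.<⇒≤ j<m)))))

chain-idc-mid : ∀ {ℓ} n (X : DPoset ℓ) g {j} → n ≤ℕ j → j ≤ℕ 2 + n →
                chain (suc n) X (idc n X g) j ≡ chain n X g n
chain-idc-mid zero    X x {j} _ _ = chain-idc-zero X x j
chain-idc-mid (suc m) X (x , y , p , c) {suc j} (s≤s m≤j) (s≤s j≤) =
  chain-suc-cong (suc m) m (idc m _ c) c j m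
    (λ _ → ≤⇒≤2* ℕₚ.≤-refl , chain-idc-mid m _ c m≤j j≤)
    (λ 2sm<j → ⊥-elim (ℕₚ.<⇒≱ 2sm<j (ℕₚ.≤-trans j≤ (≤2*⇒2+≤2*suc m (≤⇒≤2* ℕₚ.≤-refl)))))

chain-idc-> : ∀ {ℓ} n (X : DPoset ℓ) g {i} → n < i →
              chain (suc n) X (idc n X g) (2 + i) ≡ chain n X g i
chain-idc-> zero    X x {i} _ = chain-idc-zero X x (2 + i)
chain-idc-> (suc m) X (x , y , p , c) {suc i} (s≤s m<i) =
  chain-suc-cong (suc m) m (idc m _ c) c (2 + i) i
    (λ 2+i≤ → 2+≤2*suc⇒≤2* m 2+i≤ , chain-idc-> m _ c m<i)
    (2*suc<2+⇒2*< m)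

chain-src : ∀ {ℓ} n (X : DPoset ℓ) f k j → k ≤ℕ 2 * n →
            (k ≤ℕ n × j ≡ k) ⊎ (n < k × j ≡ 2 + k) → chain n X (src n X f) k ≡ chain (suc n) X f j
chain-src n X f k j _  (inj₁ (k≤n , refl)) = chain-src-≤ n X f k≤n
chain-src n X f k j k≤ (inj₂ (n<k , refl)) = chain-src-> n X f n<k k≤

chain-tgt : ∀ {ℓ} n (X : DPoset ℓ) f k j → k ≤ℕ 2 * n →
            (k < n × j ≡ k) ⊎ (n ≤ℕ k × j ≡ 2 + k) → chain n X (tgt n X f) k ≡ chain (suc n) X f j
chain-tgt n X f k j _  (inj₁ (k<n , refl)) = chain-tgt-< n X f k<n
chain-tgt n X f k j k≤ (inj₂ (n≤k , refl)) = chain-tgt-≥ n X f n≤k k≤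

chain-idc : ∀ {ℓ} n (X : DPoset ℓ) g i j →
            (j < n × i ≡ j) ⊎ (n ≤ℕ j × j ≤ℕ 2 + n × i ≡ n) ⊎ (2 + n < j × i + 2 ≡ j) →
            chain (suc n) X (idc n X g) j ≡ chain n X g i
chain-idc n X g i j (inj₁ (j<n , refl)) = chain-idc-< n X g j<n
chain-idc n X g i j (inj₂ (inj₁ (n≤j , j≤ , refl))) = chain-idc-mid n X g n≤j j≤
chain-idc n X g i j (inj₂ (inj₂ (<j , refl))) =
  trans (cong (chain (suc n) X (idc n X g)) (ℕₚ.+-comm i 2))
        (chain-idc-> n X g (ℕₚ.+-cancelʳ-< 2 n i (subst (_< i + 2) (ℕₚ.+-comm 2 n) <j)))

Comp-exists : ∀ {ℓ} n (X : DPoset ℓ) f g → src n X f ≡ tgt n X g → Σ (Cell (suc n) X) (Comp n X f g)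
Comp-exists zero X (y , z , q , φ) (x , .y , p , ψ) refl =
  (x , z , r , χ) , comp₀ (Interval.IsSum-proj₁ X r {s' = ψ'} {t = χ} (⊕-isSum {a = φ'} φ'≤))
  where
  open DPoset X hiding (Carrier)
  open DPosetProperties X using (≤-reflexive; ⊖-monoˡ-≤; ⊖-antimonoʳ-≤; ⊖-cancelʳ)
  r = ≤-trans p q
  open DPosetProperties (Hom X x z r) using (_⊕_[_]; ⊤⊖_; ⊕-isSum)
  ψ' φ' : Carrier (Hom X x z r)
  ψ' = proj₁ ψ , ≤-trans (proj₂ ψ) (⊖-monoˡ-≤ p q r)
  φ' = proj₁ φ , ≤-trans (proj₂ φ) (⊖-antimonoʳ-≤ p q r)
  -- z ⊖ y = (z ⊖ x) ⊖ (y ⊖ x) and ψ ≤ y ⊖ x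
  φ'≤ : DPoset._≤_ (Hom X x z r) φ' (⊤⊖ ψ')
  φ'≤ = ≤-trans (proj₂ φ) (≤-trans (≤-reflexive (sym (⊖-cancelʳ p q r _)))
                                    (⊖-antimonoʳ-≤ (proj₂ ψ) (⊖-monoˡ-≤ p q r) _))
  χ = φ' ⊕ ψ' [ φ'≤ ]
Comp-exists (suc m) X (x , y , p , f) (x' , y' , p' , g) eq
  with src m (Hom X x y p) f in f-src | tgt m (Hom X x' y' p') g in g-tgt
... | _ | _ with refl ← eq =
  let h , f∘g = Comp-exists m (Hom X x y p) f g (trans f-src (sym g-tgt)) in (x , y , p , h) , compₛ f∘g

chain-comp-≤ : ∀ {ℓ n} {X : DPoset ℓ} {f g h} → Comp n X f g h →
               ∀ {k} → k ≤ℕ n → chain (suc n) X h k ≡ chain (suc n) X g k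
chain-comp-≤ (comp₀ _) {zero} _ = refl
chain-comp-≤ (compₛ _) {zero} _ = refl
chain-comp-≤ (compₛ {n = m} {g = g} {h = h} f∘g) {suc k} (s≤s k≤m) =
  chain-suc-cong (suc m) (suc m) h g k k
    (λ _ → ≤⇒≤2* (ℕₚ.m≤n⇒m≤1+n k≤m) , chain-comp-≤ f∘g k≤m)
    (λ 2sm<k → ⊥-elim (ℕₚ.<⇒≱ 2sm<k (≤⇒≤2* (ℕₚ.m≤n⇒m≤1+n k≤m))))

chain-comp-≥ : ∀ {ℓ n} {X : DPoset ℓ} {f g h} → Comp n X f g h →
               ∀ {k} → 2 + n ≤ℕ k → chain (suc n) X h k ≡ chain (suc n) X f k
chain-comp-≥ (comp₀ {φ = φ} {χ = χ} _) {suc k} (s≤s 1≤k) =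
  trans (chain-suc-> 0 χ 1≤k) (sym (chain-suc-> 0 φ 1≤k))
chain-comp-≥ (compₛ {n = m} {f = f} {h = h} f∘g) {suc k} (s≤s 2+m≤k) =
  chain-suc-cong (suc m) (suc m) h f k k (λ k≤ → k≤ , chain-comp-≥ f∘g 2+m≤k) (λ <k → <k)

chain-comp-mid : ∀ {ℓ n} {X : DPoset ℓ} {f g h} → Comp n X f g h →
  (le : DPoset._≤_ X (chain (suc n) X f n) (chain (suc n) X f (suc n))) →
  IsSum X (DPoset.diff X (chain (suc n) X f (suc n)) (chain (suc n) X f n) le)
          (chain (suc n) X g (suc n)) (chain (suc n) X h (suc n))
chain-comp-mid {X = X} (comp₀ {q = q} φ⊕ψ≡χ) le =
  IsSum-cong (Interval.ι-⊖ X q le) refl refl (IsSum-⊕ʳ _ _ φ⊕ψ≡χ)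
  where open DPosetProperties X
chain-comp-mid (compₛ {n = m} {X = X} {x} {y} {p} {f} {g} {h} f∘g) le =
  IsSum-cong (trans (diff-cong (at-suc f) (at f) le (Interval.ι-mono X p le')) (Interval.ι-⊖-ι X p le' _))
             (at-suc g) (at-suc h)
             (IsSum-⊕ʳ _ _ (Interval.IsSum-proj₁ X p {s' = chain (suc m) _ g (suc m)} {t = chain (suc m) _ h (suc m)}
                                                     (chain-comp-mid f∘g le')))
  where
  open DPosetProperties X
  le' = chain-mono (suc m) _ f (ℕₚ.n≤1+n m)
  at : ∀ c → chain (suc (suc m)) X (x , y , p , c) (suc m) ≡ ι X p (chain (suc m) _ c m)
  at c = chain-suc-≤ (suc m) c {m} (≤⇒≤2* (ℕₚ.n≤1+n m))
  at-suc : ∀ c → chain (suc (suc m)) X (x , y , p , c) (suc (suc m)) ≡ ι X p (chain (suc m) _ c (suc m))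
  at-suc c = chain-suc-≤ (suc m) c {suc m} (≤⇒≤2* ℕₚ.≤-refl)

module _ {ℓ} (X : DPoset ℓ) where

  cellMap : (n : ℕ) → Cell n X → Fin (suc (2 * n)) → Carrier X
  cellMap n c i = chain n X c (toℕ i)

  cellMap-injective : ∀ n c d → (∀ i → cellMap n c i ≡ cellMap n d i) → c ≡ d
  cellMap-injective n c d agree = chain-injective n X c d λ k k≤ →
    subst (λ k → chain n X c k ≡ chain n X d k) (Finₚ.toℕ-fromℕ< (s≤s k≤)) (agree (fromℕ< (s≤s k≤)))

  cellMap-surjective : ∀ n (f : Fin (suc (2 * n)) → Carrier X) → IsMonotone X f →
                       Σ (Cell n X) λ c → ∀ i → cellMap n c i ≡ f i
  cellMap-surjective n f f-mono =
    proj₁ extension , λ i → trans (proj₂ extension (toℕ i) (Finₚ.toℕ≤pred[n] i)) (cong f (clamp-toℕ i))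
    where
    clamp : ℕ → Fin (suc (2 * n))
    clamp k = fromℕ< (s≤s (ℕₚ.m⊓n≤n k (2 * n)))
    clamp-toℕ : ∀ i → clamp (toℕ i) ≡ i
    clamp-toℕ i = Finₚ.toℕ-injective (trans (Finₚ.toℕ-fromℕ< _) (ℕₚ.m≤n⇒m⊓n≡m (Finₚ.toℕ≤pred[n] i)))
    extension = chain-surjective n X (f ∘ clamp) λ k≤l →
      f-mono _ _ (subst₂ _≤ℕ_ (sym (Finₚ.toℕ-fromℕ< _)) (sym (Finₚ.toℕ-fromℕ< _)) (ℕₚ.⊓-monoˡ-≤ (2 * n) k≤l))

  cellMap-comp-mid : ∀ {n f g h} → Comp n X f g h → ∀ i k → toℕ i ≡ suc n → toℕ k ≡ n →
    (le : DPoset._≤_ X (cellMap (suc n) f k) (cellMap (suc n) f i)) →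
    IsSum X (DPoset.diff X (cellMap (suc n) f i) (cellMap (suc n) f k) le)
            (cellMap (suc n) g i) (cellMap (suc n) h i)
  cellMap-comp-mid f∘g i k i≡ k≡ rewrite i≡ | k≡ = chain-comp-mid f∘g

mainTheorem7 : ∀ {ℓ} (X : DPoset ℓ) →
    Σ ((n : ℕ) → Cell n X → Fin (suc (2 * n)) → DPoset.Carrier X) λ Θ →
      (∀ x i → Θ zero x i ≡ x)
      × (∀ n c → IsMonotone X (Θ n c))
      × (∀ n c d → (∀ i → Θ n c i ≡ Θ n d i) → c ≡ d)
      × (∀ n (f : Fin (suc (2 * n)) → DPoset.Carrier X) → IsMonotone X f →
           Σ (Cell n X) λ c → ∀ i → Θ n c i ≡ f i)
      × (∀ n (f : Cell (suc n) X) (i : Fin (suc (2 * n))) (j : Fin (suc (2 * suc n))) →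
           ((toℕ i ≤ℕ n × toℕ j ≡ toℕ i) ⊎ (n < toℕ i × toℕ j ≡ 2 + toℕ i)) →
           Θ n (src n X f) i ≡ Θ (suc n) f j)
      × (∀ n (f : Cell (suc n) X) (i : Fin (suc (2 * n))) (j : Fin (suc (2 * suc n))) →
           ((toℕ i < n × toℕ j ≡ toℕ i) ⊎ (n ≤ℕ toℕ i × toℕ j ≡ 2 + toℕ i)) →
           Θ n (tgt n X f) i ≡ Θ (suc n) f j)
      × (∀ n (g : Cell n X) (i : Fin (suc (2 * n))) (j : Fin (suc (2 * suc n))) →
           ((toℕ j < n × toℕ i ≡ toℕ j)
             ⊎ (n ≤ℕ toℕ j × toℕ j ≤ℕ 2 + n × toℕ i ≡ n)
             ⊎ (2 + n < toℕ j × toℕ i + 2 ≡ toℕ j)) →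
           Θ (suc n) (idc n X g) j ≡ Θ n g i)
      × (∀ n (f g : Cell (suc n) X) → src n X f ≡ tgt n X g →
           Σ (Cell (suc n) X) (Comp n X f g)
           × (∀ h → Comp n X f g h →
                (∀ i → toℕ i ≤ℕ n → Θ (suc n) h i ≡ Θ (suc n) g i)
                × (∀ i → 2 + n ≤ℕ toℕ i → Θ (suc n) h i ≡ Θ (suc n) f i)
                × (∀ i k → toℕ i ≡ suc n → toℕ k ≡ n →
                     (le : DPoset._≤_ X (Θ (suc n) f k) (Θ (suc n) f i)) →
                     IsSum X (DPoset.diff X (Θ (suc n) f i) (Θ (suc n) f k) le)
                             (Θ (suc n) g i) (Θ (suc n) h i))))
mainTheorem7 X =
  cellMap X
  , (λ x i → refl)
  , (λ n c i j → chain-mono n X c)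
  , cellMap-injective X
  , cellMap-surjective X
  , (λ n f i j → chain-src n X f (toℕ i) (toℕ j) (Finₚ.toℕ≤pred[n] i))
  , (λ n f i j → chain-tgt n X f (toℕ i) (toℕ j) (Finₚ.toℕ≤pred[n] i))
  , (λ n g i j → chain-idc n X g (toℕ i) (toℕ j))
  , λ n f g src≡tgt → Comp-exists n X f g src≡tgt
                    , λ h f∘g → (λ i → chain-comp-≤ f∘g) , (λ i → chain-comp-≥ f∘g) , cellMap-comp-mid X f∘g
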